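{- Let $C$ be an extremal even self-dual linear Kleinian code of length $n=6k$. Then for every $w\ge1$ such that $C$ contains a codeword of weight $w$, the set of codewords of $C$ of weight $w$ forms a generalized $2$-$(n,w,\mu)$ design for some $\mu$.
   Context: Let $K=\{0,a,b,c\}$ be the Kleinian four-group. A linear code of length $n$ is a subgroup $C\subseteq K^n$; $\mathrm{wt}(\mathbf{x})$ is the number of nonzero coordinates and the minimal weight $d$ is the least weight of a nonzero codeword. Define $x\cdot y\in\mathbb{F}_2$ for $x,y\in K$ by $x\cdot y=1$ iff $x,y$ are nonzero and distinct; $(\mathbf{x},\mathbf{y})=\sum_ix_i\cdot y_i$; $C^\perp=\{\mathbf{x}:(\mathbf{x},\mathbf{y})=0\ \forall \mathbf{y}\in C\}$; $C$ is self-dual if $C=C^\perp$, even if all codewords have even weight. An even self-dual code of length $n$ is extremal if $d=2\lfloor n/6\rfloor+2$. Let $X_j=\{\mathbf{x}\in K^n:\mathrm{wt}(\mathbf{x})=j\}$. An element $\mathbf{x}\in K^n$ is covered by $\mathbf{y}\in K^n$ if $y_i=x_i$ for every $i$ with $x_i\neq0$. A generalized $t$-$(n,w,\mu)$ design is a nonempty subset $Y\subseteq X_w$ such that every element of $X_t$ is covered by exactly $\mu$ elements of $Y$. -}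

module Defs where

open import Data.Nat using (ℕ; zero; suc; _+_; _*_; _≤_)
open import Data.Nat.Divisibility using (_∣_)
open import Data.Nat.DivMod using (_/_)
open import Data.Bool using (Bool; true; false; _∧_; _∨_; _xor_; not; if_then_else_)
open import Data.Vec using (Vec; []; _∷_; zipWith; replicate)
open import Data.List using (List; []; _∷_; map; concatMap; filter; length)
open import Data.Product using (Σ; _×_; _,_; ∃)
open import Relation.Binary.PropositionalEquality using (_≡_; _≢_)
open import Function.Bundles using (_⇔_)
open import Relation.Nullary using (Dec; yes; no)
open import Data.Nat using (_≟_)
open import Data.Bool using (T)
open import Relation.Nullary.Decidable using (⌊_⌋)
import Data.List.Membership.Propositional
import Data.Nat

data K : Set where
  𝟘 a b c : K

_⊕_ : K → K → K
𝟘 ⊕ y = y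
x ⊕ 𝟘 = x
a ⊕ a = 𝟘
a ⊕ b = c
a ⊕ c = b
b ⊕ a = c
b ⊕ b = 𝟘
b ⊕ c = a
c ⊕ a = b
c ⊕ b = a
c ⊕ c = 𝟘

isNonzero : K → Bool
isNonzero 𝟘 = false
isNonzero _ = true

eqK : K → K → Bool
eqK 𝟘 𝟘 = true
eqK a a = true
eqK b b = true
eqK c c = true
eqK _ _ = false

_·_ : K → K → Bool
x · y = isNonzero x ∧ isNonzero y ∧ not (eqK x y)

Word : ℕ → Set
Word n = Vec K n

zeroW : ∀ {n} → Word n
zeroW = replicate _ 𝟘

_⊕ᵥ_ : ∀ {n} → Word n → Word n → Word n
_⊕ᵥ_ = zipWith _⊕_

wt : ∀ {n} → Word n → ℕ
wt [] = 0
wt (x ∷ xs) = (if isNonzero x then 1 else 0) + wt xs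

ip : ∀ {n} → Word n → Word n → Bool
ip [] [] = false
ip (x ∷ xs) (y ∷ ys) = (x · y) xor ip xs ys

-- x is covered by y : yᵢ = xᵢ whenever xᵢ ≠ 0
covers : ∀ {n} → Word n → Word n → Bool
covers [] [] = true
covers (x ∷ xs) (y ∷ ys) = (not (isNonzero x) ∨ eqK x y) ∧ covers xs ys

allWords : (n : ℕ) → List (Word n)
allWords zero = [] ∷ []
allWords (suc n) = concatMap (λ x → map (x ∷_) (allWords n)) (𝟘 ∷ a ∷ b ∷ c ∷ [])

-- A linear Kleinian code: a subgroup of K^n, given by its (Boolean) membership predicate
record Code (n : ℕ) : Set where
  field
    mem      : Word n → Bool
    zero-mem : mem zeroW ≡ true
    add-mem  : ∀ x y → mem x ≡ true → mem y ≡ true → mem (x ⊕ᵥ y) ≡ true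
open Code public

_∈C_ : ∀ {n} → Word n → Code n → Set
x ∈C C = mem C x ≡ true

SelfDual : ∀ {n} → Code n → Set
SelfDual {n} C = ∀ (x : Word n) → (x ∈C C) ⇔ (∀ (y : Word n) → y ∈C C → ip x y ≡ false)

Even : ∀ {n} → Code n → Set
Even {n} C = ∀ (x : Word n) → x ∈C C → 2 ∣ wt x

MinWeight : ∀ {n} → Code n → ℕ → Set
MinWeight {n} C d =
  (∀ (x : Word n) → x ∈C C → x ≢ zeroW → d ≤ wt x)
  × (Σ (Word n) λ x → x ∈C C × x ≢ zeroW × wt x ≡ d)

Extremal : ∀ {n} → Code n → Set
Extremal {n} C = SelfDual C × Even C × MinWeight C (2 * (n / 6) + 2)

-- codewords of C of weight w, as a list (each codeword exactly once)
codewordsOfWeight : ∀ {n} → Code n → ℕ → List (Word n)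
codewordsOfWeight {n} C w =
  filter (λ y → T? (mem C y ∧ ⌊ wt y ≟ w ⌋)) (allWords n)
  where
  T? : (β : Bool) → Dec (T β)
  T? true = yes _
  T? false = no (λ ())

coverCount : ∀ {n} → List (Word n) → Word n → ℕ
coverCount Y x = length (filter (λ y → T? (covers x y)) Y)
  where
  T? : (β : Bool) → Dec (T β)
  T? true = yes _
  T? false = no (λ ())

GenDesign : ∀ {n} → ℕ → ℕ → ℕ → List (Word n) → Set
GenDesign {n} t w μ Y =
  (0 Data.Nat.< length Y)
  × (∀ (y : Word n) → y Data.List.Membership.Propositional.∈ Y → wt y ≡ w)
  × (∀ (x : Word n) → wt x ≡ t → coverCount Y x ≡ μ)

-- Assmus–Mattson by Fourier analysis on Kⁿ. Since C = C^⊥ and every nonzero codeword has weight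
-- at least d = 2k + 2, the Fourier transform of the indicator of C vanishes at the nonzero words of
-- weight < d; by Plancherel, C then averages every function of fewer than d coordinates exactly as
-- Kⁿ does (C is an orthogonal array of strength d − 1). For x of weight 2 and a polynomial p of
-- degree < d − 2 this makes the sum of p (zeros v) over the codewords v covering x independent of x,
-- where zeros v counts the zero coordinates of v. A nonzero codeword has even weight between 2k + 2
-- and 6k, so zeros v is one of the 2k values 0, 2, …, 4k − 2; the polynomial of degree 2k − 1
-- vanishing at all of them but 6k − w isolates the codewords of weight w, and so the number of them
-- covering x is the same for every x of weight 2.

module Submission where

open import Algebra.Bundles using (CommutativeRing)
open import Data.Bool using (Bool; true; false; not; _∧_; _xor_; T; if_then_else_)
open import Data.Bool.Properties using (xor-∧-commutativeRing; xor-identityʳ; T-≡)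
open import Data.Fin using (Fin; zero; suc)
open import Data.Fin.Subset using (Subset; ⁅_⁆; _∪_; ∣_∣; _⊆_)
  renaming (_∈_ to _∈ₛ_; _∉_ to _∉ₛ_)
open import Data.Fin.Subset.Properties using (_∈?_; p⊆q⇒∣p∣≤∣q∣; x∈⁅x⁆; x∈p∪q⁺)
open import Data.Nat as ℕ using (ℕ; zero; suc; _≤_; _<_; z≤n; s≤s)
import Data.Nat.Properties as ℕ
open import Data.Product using (Σ; ∃; _×_; _,_; proj₁; proj₂)
open import Data.Sum using (inj₁; inj₂)
open import Data.Empty using (⊥-elim)
open import Data.List using (List; []; _∷_; map)
open import Data.List.Membership.Propositional using (_∈_)
open import Data.List.Membership.Propositional.Properties using (∈-map⁺; ∈-concatMap⁺)
open import Data.List.Relation.Unary.Any as Any using (here; there)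
open import Data.Vec as Vec using (Vec; []; _∷_; lookup; _[_]≔_; here; there)
open import Data.Vec.Properties
  using (lookup-map; lookup-replicate; lookup-zipWith; lookup∘update′; []=⇒lookup)
open import Function using (_∘_; Equivalence; mk⇔)
open import Relation.Binary.PropositionalEquality
  using (_≡_; _≢_; refl; sym; trans; cong; cong₂; subst; subst₂; module ≡-Reasoning)
open import Relation.Nullary using (¬_; Dec)
open import Relation.Nullary.Decidable using (decidable-stable)

open import Algebra.Properties.CommutativeSemigroup
  (CommutativeRing.+-commutativeSemigroup xor-∧-commutativeRing)
  using () renaming (interchange to xor-interchange)

open import Defs

private
  variable
    n : ℕ

isZero : K → Bool
isZero x = not (isNonzero x)

⊕-identityʳ : ∀ x → x ⊕ 𝟘 ≡ x
⊕-identityʳ 𝟘 = refl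
⊕-identityʳ a = refl
⊕-identityʳ b = refl
⊕-identityʳ c = refl

x⊕y⊕y≡x : ∀ x y → (x ⊕ y) ⊕ y ≡ x
x⊕y⊕y≡x 𝟘 𝟘 = refl; x⊕y⊕y≡x 𝟘 a = refl; x⊕y⊕y≡x 𝟘 b = refl; x⊕y⊕y≡x 𝟘 c = refl
x⊕y⊕y≡x a 𝟘 = refl; x⊕y⊕y≡x a a = refl; x⊕y⊕y≡x a b = refl; x⊕y⊕y≡x a c = refl
x⊕y⊕y≡x b 𝟘 = refl; x⊕y⊕y≡x b a = refl; x⊕y⊕y≡x b b = refl; x⊕y⊕y≡x b c = refl
x⊕y⊕y≡x c 𝟘 = refl; x⊕y⊕y≡x c a = refl; x⊕y⊕y≡x c b = refl; x⊕y⊕y≡x c c = refl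

·-zeroʳ : ∀ x → x · 𝟘 ≡ false
·-zeroʳ 𝟘 = refl
·-zeroʳ a = refl
·-zeroʳ b = refl
·-zeroʳ c = refl

·-distribˡ-⊕ : ∀ x y z → x · (y ⊕ z) ≡ (x · y) xor (x · z)
·-distribˡ-⊕ 𝟘 _ _ = refl
·-distribˡ-⊕ a 𝟘 _ = refl; ·-distribˡ-⊕ b 𝟘 _ = refl; ·-distribˡ-⊕ c 𝟘 _ = refl
·-distribˡ-⊕ a a 𝟘 = refl; ·-distribˡ-⊕ a a a = refl; ·-distribˡ-⊕ a a b = refl; ·-distribˡ-⊕ a a c = refl
·-distribˡ-⊕ a b 𝟘 = refl; ·-distribˡ-⊕ a b a = refl; ·-distribˡ-⊕ a b b = refl; ·-distribˡ-⊕ a b c = refl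
·-distribˡ-⊕ a c 𝟘 = refl; ·-distribˡ-⊕ a c a = refl; ·-distribˡ-⊕ a c b = refl; ·-distribˡ-⊕ a c c = refl
·-distribˡ-⊕ b a 𝟘 = refl; ·-distribˡ-⊕ b a a = refl; ·-distribˡ-⊕ b a b = refl; ·-distribˡ-⊕ b a c = refl
·-distribˡ-⊕ b b 𝟘 = refl; ·-distribˡ-⊕ b b a = refl; ·-distribˡ-⊕ b b b = refl; ·-distribˡ-⊕ b b c = refl
·-distribˡ-⊕ b c 𝟘 = refl; ·-distribˡ-⊕ b c a = refl; ·-distribˡ-⊕ b c b = refl; ·-distribˡ-⊕ b c c = refl
·-distribˡ-⊕ c a 𝟘 = refl; ·-distribˡ-⊕ c a a = refl; ·-distribˡ-⊕ c a b = refl; ·-distribˡ-⊕ c a c = refl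
·-distribˡ-⊕ c b 𝟘 = refl; ·-distribˡ-⊕ c b a = refl; ·-distribˡ-⊕ c b b = refl; ·-distribˡ-⊕ c b c = refl
·-distribˡ-⊕ c c 𝟘 = refl; ·-distribˡ-⊕ c c a = refl; ·-distribˡ-⊕ c c b = refl; ·-distribˡ-⊕ c c c = refl

·-nondegenerate : ∀ x → T (isNonzero x) → ∃ λ y → x · y ≡ true
·-nondegenerate a _ = b , refl
·-nondegenerate b _ = a , refl
·-nondegenerate c _ = a , refl

⊕ᵥ-identityˡ : (v : Word n) → zeroW ⊕ᵥ v ≡ v
⊕ᵥ-identityˡ []      = refl
⊕ᵥ-identityˡ (x ∷ v) = cong (x ∷_) (⊕ᵥ-identityˡ v)

x⊕ᵥy⊕ᵥy≡x : (v u : Word n) → (v ⊕ᵥ u) ⊕ᵥ u ≡ v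
x⊕ᵥy⊕ᵥy≡x []      []      = refl
x⊕ᵥy⊕ᵥy≡x (x ∷ v) (y ∷ u) = cong₂ _∷_ (x⊕y⊕y≡x x y) (x⊕ᵥy⊕ᵥy≡x v u)

ip-zeroˡ : (u : Word n) → ip zeroW u ≡ false
ip-zeroˡ []      = refl
ip-zeroˡ (_ ∷ u) = ip-zeroˡ u

ip-zeroʳ : (u : Word n) → ip u zeroW ≡ false
ip-zeroʳ []      = refl
ip-zeroʳ (x ∷ u) = cong₂ _xor_ (·-zeroʳ x) (ip-zeroʳ u)

ip-distribˡ-⊕ᵥ : (u w v : Word n) → ip u (w ⊕ᵥ v) ≡ ip u w xor ip u v
ip-distribˡ-⊕ᵥ []      []      []      = refl
ip-distribˡ-⊕ᵥ (x ∷ u) (y ∷ w) (z ∷ v) =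
  trans (cong₂ _xor_ (·-distribˡ-⊕ x y z) (ip-distribˡ-⊕ᵥ u w v))
        (xor-interchange (x · y) (x · z) (ip u w) (ip u v))

ip-single : (u : Word n) (i : Fin n) (y : K) → ip u (zeroW [ i ]≔ y) ≡ lookup u i · y
ip-single (x ∷ u) zero    y = trans (cong ((x · y) xor_) (ip-zeroʳ u)) (xor-identityʳ (x · y))
ip-single (x ∷ u) (suc i) y = trans (cong (_xor ip u (zeroW [ i ]≔ y)) (·-zeroʳ x)) (ip-single u i y)

zeros : Word n → ℕ
zeros []      = 0
zeros (x ∷ v) = if isNonzero x then zeros v else suc (zeros v)

wt+zeros : (v : Word n) → wt v ℕ.+ zeros v ≡ n
wt+zeros []      = refl
wt+zeros (𝟘 ∷ v) = trans (ℕ.+-suc (wt v) (zeros v)) (cong suc (wt+zeros v))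
wt+zeros (a ∷ v) = cong suc (wt+zeros v)
wt+zeros (b ∷ v) = cong suc (wt+zeros v)
wt+zeros (c ∷ v) = cong suc (wt+zeros v)

zeros-cong-wt : (v w : Word n) → wt v ≡ wt w → zeros v ≡ zeros w
zeros-cong-wt v w eq = ℕ.+-cancelˡ-≡ (wt v) (zeros v) (zeros w)
  (trans (wt+zeros v) (sym (trans (cong (ℕ._+ zeros w) eq) (wt+zeros w))))

wt-cong-zeros : (v w : Word n) → zeros v ≡ zeros w → wt v ≡ wt w
wt-cong-zeros v w eq = ℕ.+-cancelʳ-≡ (zeros v) (wt v) (wt w)
  (trans (wt+zeros v) (sym (trans (cong (wt w ℕ.+_) eq) (wt+zeros w))))

support : Word n → Subset n
support = Vec.map isNonzero

wt≡∣support∣ : (v : Word n) → wt v ≡ ∣ support v ∣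
wt≡∣support∣ []      = refl
wt≡∣support∣ (𝟘 ∷ v) = wt≡∣support∣ v
wt≡∣support∣ (a ∷ v) = cong suc (wt≡∣support∣ v)
wt≡∣support∣ (b ∷ v) = cong suc (wt≡∣support∣ v)
wt≡∣support∣ (c ∷ v) = cong suc (wt≡∣support∣ v)

∈-support : (v : Word n) {i : Fin n} → i ∈ₛ support v → T (isNonzero (lookup v i))
∈-support v {i} i∈ = Equivalence.from T-≡ (trans (sym (lookup-map i isNonzero v)) ([]=⇒lookup i∈))

covers-zeroW : (x : Word n) → covers x zeroW ≡ true → wt x ≡ 0
covers-zeroW []      _  = refl
covers-zeroW (𝟘 ∷ x) eq = covers-zeroW x eq
covers-zeroW (a ∷ x) ()
covers-zeroW (b ∷ x) ()
covers-zeroW (c ∷ x) ()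

∣p∪q∣≤∣p∣+∣q∣ : (p q : Subset n) → ∣ p ∪ q ∣ ≤ ∣ p ∣ ℕ.+ ∣ q ∣
∣p∪q∣≤∣p∣+∣q∣ []          []          = z≤n
∣p∪q∣≤∣p∣+∣q∣ (true ∷ p)  (true ∷ q)  =
  s≤s (ℕ.≤-trans (∣p∪q∣≤∣p∣+∣q∣ p q) (ℕ.+-monoʳ-≤ ∣ p ∣ (ℕ.n≤1+n ∣ q ∣)))
∣p∪q∣≤∣p∣+∣q∣ (true ∷ p)  (false ∷ q) = s≤s (∣p∪q∣≤∣p∣+∣q∣ p q)
∣p∪q∣≤∣p∣+∣q∣ (false ∷ p) (true ∷ q)  =
  subst (suc ∣ p ∪ q ∣ ≤_) (sym (ℕ.+-suc ∣ p ∣ ∣ q ∣)) (s≤s (∣p∪q∣≤∣p∣+∣q∣ p q))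
∣p∪q∣≤∣p∣+∣q∣ (false ∷ p) (false ∷ q) = ∣p∪q∣≤∣p∣+∣q∣ p q

VanishesOn : Word n → Subset n → Set
VanishesOn e S = ∀ {i} → i ∈ₛ S → lookup e i ≡ 𝟘

DependsOn : {A : Set} → Subset n → (Word n → A) → Set
DependsOn S F = ∀ v e → VanishesOn e S → F (v ⊕ᵥ e) ≡ F v

single-vanishesOn : {S : Subset n} {i : Fin n} (y : K) → i ∉ₛ S → VanishesOn (zeroW [ i ]≔ y) S
single-vanishesOn {i = i} y i∉S {j} j∈S =
  trans (lookup∘update′ (λ j≡i → i∉S (subst (_∈ₛ _) j≡i j∈S)) zeroW y)
        (lookup-replicate j 𝟘)

vanishesOn-head : {e : Word n} {S : Subset n} {z : K} →
                  VanishesOn (z ∷ e) (true ∷ S) → ∀ y → y ⊕ z ≡ y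
vanishesOn-head h y = trans (cong (y ⊕_) (h here)) (⊕-identityʳ y)

vanishesOn-tail : {e : Word n} {S : Subset n} {z : K} {s : Bool} →
                  VanishesOn (z ∷ e) (s ∷ S) → VanishesOn e S
vanishesOn-tail h i∈S = h (there i∈S)

dependsOn-∘ : {A B : Set} {S : Subset n} {F : Word n → A} (g : A → B) →
              DependsOn S F → DependsOn S (g ∘ F)
dependsOn-∘ g dep v e h = cong g (dep v e h)

dependsOn-∪ : {A B C : Set} {S S′ : Subset n} {F : Word n → A} {G : Word n → B} (_∙_ : A → B → C) →
              DependsOn S F → DependsOn S′ G → DependsOn (S ∪ S′) (λ v → F v ∙ G v)
dependsOn-∪ _∙_ depF depG v e h =
  cong₂ _∙_ (depF v e (λ i∈S → h (x∈p∪q⁺ (inj₁ i∈S))))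
            (depG v e (λ i∈S′ → h (x∈p∪q⁺ (inj₂ i∈S′))))

lookup-dependsOn : (i : Fin n) → DependsOn ⁅ i ⁆ (λ v → lookup v i)
lookup-dependsOn i v e h =
  trans (lookup-zipWith _⊕_ i v e)
        (trans (cong (lookup v i ⊕_) (h (x∈⁅x⁆ i))) (⊕-identityʳ (lookup v i)))

covers-dependsOn : (x : Word n) → DependsOn (support x) (covers x)
covers-dependsOn []      []      []      _ = refl
covers-dependsOn (𝟘 ∷ x) (_ ∷ v) (_ ∷ e) h = covers-dependsOn x v e (vanishesOn-tail h)
covers-dependsOn (a ∷ x) (y ∷ v) (_ ∷ e) h =
  cong₂ _∧_ (cong (eqK a) (vanishesOn-head h y)) (covers-dependsOn x v e (vanishesOn-tail h))
covers-dependsOn (b ∷ x) (y ∷ v) (_ ∷ e) h =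
  cong₂ _∧_ (cong (eqK b) (vanishesOn-head h y)) (covers-dependsOn x v e (vanishesOn-tail h))
covers-dependsOn (c ∷ x) (y ∷ v) (_ ∷ e) h =
  cong₂ _∧_ (cong (eqK c) (vanishesOn-head h y)) (covers-dependsOn x v e (vanishesOn-tail h))

wt-zeroW : wt (zeroW {n}) ≡ 0
wt-zeroW {zero}  = refl
wt-zeroW {suc n} = wt-zeroW {n}

weight-two-word : 2 ≤ n → Σ (Word n) λ x → wt x ≡ 2
weight-two-word {suc zero}    (s≤s ())
weight-two-word {suc (suc n)} _ = a ∷ a ∷ zeroW , cong (2 ℕ.+_) (wt-zeroW {n})

∈-allWords : (v : Word n) → v ∈ allWords n
∈-allWords []      = here refl
∈-allWords (x ∷ v) =
  ∈-concatMap⁺ (λ y → map (y ∷_) (allWords _)) (position x (∈-map⁺ (x ∷_) (∈-allWords v)))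
  where
  position : {P : K → Set} (x : K) → P x → Any.Any P (𝟘 ∷ a ∷ b ∷ c ∷ [])
  position 𝟘 p = here p
  position a p = there (here p)
  position b p = there (there (here p))
  position c p = there (there (there (here p)))

module Sums where

  open import Data.Integer using (ℤ; +_; -_; _+_; _*_; 0ℤ; 1ℤ)
  open import Data.Integer.Properties
    using (+-identityˡ; +-identityʳ; +-assoc; *-identityˡ; *-comm; -1*i≡-i; +-*-semiring)
  open import Data.Integer.Tactic.RingSolver using (solve-∀)
  open import Algebra.Properties.Semiring.Sum +-*-semiring using (sum-syntax)
  open import Data.List using (_++_; length; filter)
  open import Data.List.Properties using (filter-accept; filter-reject)
  open ≡-Reasoning

  private
    variable
      A B : Set

  ⟦_⟧ : Bool → ℤ
  ⟦ true ⟧  = 1ℤ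
  ⟦ false ⟧ = 0ℤ

  ⟦∧⟧ : ∀ p q → ⟦ p ∧ q ⟧ ≡ ⟦ p ⟧ * ⟦ q ⟧
  ⟦∧⟧ false false = refl
  ⟦∧⟧ false true  = refl
  ⟦∧⟧ true  false = refl
  ⟦∧⟧ true  true  = refl

  sumK : (K → ℤ) → ℤ
  sumK f = f 𝟘 + f a + f b + f c

  sumW : ∀ n → (Word n → ℤ) → ℤ
  sumW zero    f = f []
  sumW (suc n) f = sumK (λ x → sumW n (λ v → f (x ∷ v)))

  sumK-cong : {f g : K → ℤ} → (∀ x → f x ≡ g x) → sumK f ≡ sumK g
  sumK-cong eq = cong₂ _+_ (cong₂ _+_ (cong₂ _+_ (eq 𝟘) (eq a)) (eq b)) (eq c)

  sumW-cong : {f g : Word n → ℤ} → (∀ v → f v ≡ g v) → sumW n f ≡ sumW n g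
  sumW-cong {zero}  eq = eq []
  sumW-cong {suc n} eq = sumK-cong (λ x → sumW-cong (λ v → eq (x ∷ v)))

  sumK-distrib-+ : (f g : K → ℤ) → sumK (λ x → f x + g x) ≡ sumK f + sumK g
  sumK-distrib-+ f g = regroup (f 𝟘) (f a) (f b) (f c) (g 𝟘) (g a) (g b) (g c)
    where
    regroup : ∀ p q r s p′ q′ r′ s′ →
              p + p′ + (q + q′) + (r + r′) + (s + s′) ≡ p + q + r + s + (p′ + q′ + r′ + s′)
    regroup = solve-∀

  *-distribˡ-sumK : (s : ℤ) (f : K → ℤ) → s * sumK f ≡ sumK (λ x → s * f x)
  *-distribˡ-sumK s f = distrib s (f 𝟘) (f a) (f b) (f c)
    where
    distrib : ∀ s p q r t → s * (p + q + r + t) ≡ s * p + s * q + s * r + s * t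
    distrib = solve-∀

  sumW-distrib-+ : (f g : Word n → ℤ) → sumW n (λ v → f v + g v) ≡ sumW n f + sumW n g
  sumW-distrib-+ {zero}  f g = refl
  sumW-distrib-+ {suc n} f g =
    trans (sumK-cong (λ x → sumW-distrib-+ (f ∘ (x ∷_)) (g ∘ (x ∷_))))
          (sumK-distrib-+ (λ x → sumW n (f ∘ (x ∷_))) (λ x → sumW n (g ∘ (x ∷_))))

  *-distribˡ-sumW : (s : ℤ) (f : Word n → ℤ) → s * sumW n f ≡ sumW n (λ v → s * f v)
  *-distribˡ-sumW {zero}  s f = refl
  *-distribˡ-sumW {suc n} s f =
    trans (*-distribˡ-sumK s (λ x → sumW n (f ∘ (x ∷_))))
          (sumK-cong (λ x → *-distribˡ-sumW s (f ∘ (x ∷_))))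

  *-distribʳ-sumW : (s : ℤ) (f : Word n → ℤ) → sumW n f * s ≡ sumW n (λ v → f v * s)
  *-distribʳ-sumW s f =
    trans (*-comm _ s) (trans (*-distribˡ-sumW s f) (sumW-cong (λ v → *-comm s (f v))))

  sumW-zero : sumW n (λ _ → 0ℤ) ≡ 0ℤ
  sumW-zero {zero}  = refl
  sumW-zero {suc n} rewrite sumW-zero {n} = refl

  sumW-neg : (f : Word n → ℤ) → sumW n (λ v → - f v) ≡ - sumW n f
  sumW-neg f = begin
    sumW _ (λ v → - f v)       ≡⟨ sumW-cong (λ v → sym (-1*i≡-i (f v))) ⟩
    sumW _ (λ v → - 1ℤ * f v)  ≡⟨ *-distribˡ-sumW (- 1ℤ) f ⟨
    - 1ℤ * sumW _ f            ≡⟨ -1*i≡-i _ ⟩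
    - sumW _ f                 ∎

  sumK-sumW-comm : (h : K → Word n → ℤ) →
                   sumK (λ x → sumW n (h x)) ≡ sumW n (λ w → sumK (λ x → h x w))
  sumK-sumW-comm {n} h = sym
    (trans (sumW-distrib-+ (λ w → h 𝟘 w + h a w + h b w) (h c))
    (cong (_+ sumW n (h c)) (trans (sumW-distrib-+ (λ w → h 𝟘 w + h a w) (h b))
    (cong (_+ sumW n (h b)) (sumW-distrib-+ (h 𝟘) (h a))))))

  sumW-comm : ∀ m (g : Word m → Word n → ℤ) →
              sumW m (λ u → sumW n (g u)) ≡ sumW n (λ w → sumW m (λ u → g u w))
  sumW-comm zero    g = refl
  sumW-comm (suc m) g =
    trans (sumK-cong (λ x → sumW-comm m (g ∘ (x ∷_))))
          (sumK-sumW-comm (λ x w → sumW m (λ u → g (x ∷ u) w)))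

  sumK-translate : (h : K → ℤ) (y : K) → sumK (λ x → h (x ⊕ y)) ≡ sumK h
  sumK-translate h 𝟘 = refl
  sumK-translate h a = swap-within (h 𝟘) (h a) (h b) (h c)
    where
    swap-within : ∀ p q r s → q + p + s + r ≡ p + q + r + s
    swap-within = solve-∀
  sumK-translate h b = swap-pairs (h 𝟘) (h a) (h b) (h c)
    where
    swap-pairs : ∀ p q r s → r + s + p + q ≡ p + q + r + s
    swap-pairs = solve-∀
  sumK-translate h c = reverse (h 𝟘) (h a) (h b) (h c)
    where
    reverse : ∀ p q r s → s + r + q + p ≡ p + q + r + s
    reverse = solve-∀

  sumW-translate : (f : Word n → ℤ) (u : Word n) → sumW n (λ v → f (v ⊕ᵥ u)) ≡ sumW n f
  sumW-translate {zero}  f []       = refl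
  sumW-translate {suc n} f (y ∷ u) =
    trans (sumK-cong (λ x → sumW-translate (λ v → f ((x ⊕ y) ∷ v)) u))
          (sumK-translate (λ x → sumW n (λ v → f (x ∷ v))) y)

  sumW-concentrated : (h : Word n → ℤ) → (∀ v → v ≢ zeroW → h v ≡ 0ℤ) → sumW n h ≡ h zeroW
  sumW-concentrated {zero}  h _  = refl
  sumW-concentrated {suc n} h h0 = begin
    sumK (λ x → sumW n (λ v → h (x ∷ v)))
      ≡⟨ cong₂ _+_ (cong₂ _+_ (cong₂ _+_ (sumW-concentrated (h ∘ (𝟘 ∷_)) h0-tail)
                                          (off a (λ ())))
                              (off b (λ ())))
                   (off c (λ ())) ⟩
    h zeroW + 0ℤ + 0ℤ + 0ℤ
      ≡⟨ trans (+-identityʳ _) (trans (+-identityʳ _) (+-identityʳ _)) ⟩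
    h zeroW ∎
    where
    h0-tail : ∀ v → v ≢ zeroW → h (𝟘 ∷ v) ≡ 0ℤ
    h0-tail v v≢0 = h0 (𝟘 ∷ v) (v≢0 ∘ cong Vec.tail)
    off : ∀ x → x ≢ 𝟘 → sumW n (λ v → h (x ∷ v)) ≡ 0ℤ
    off x x≢𝟘 = trans (sumW-cong (λ v → h0 (x ∷ v) (x≢𝟘 ∘ cong Vec.head))) (sumW-zero {n})

  sumList : (A → ℤ) → List A → ℤ
  sumList f []       = 0ℤ
  sumList f (x ∷ xs) = f x + sumList f xs

  sumList-filter : (p : A → Bool) (P? : ∀ x → Dec (T (p x))) (f : A → ℤ) (xs : List A) →
                   sumList f (filter P? xs) ≡ sumList (λ x → ⟦ p x ⟧ * f x) xs
  sumList-filter p P? f []       = refl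
  sumList-filter p P? f (x ∷ xs) with p x in px
  ... | true  = trans (cong (sumList f) (filter-accept P? (Equivalence.from T-≡ px)))
                      (cong₂ _+_ (sym (*-identityˡ (f x))) (sumList-filter p P? f xs))
  ... | false = trans (cong (sumList f) (filter-reject P? (subst T px)))
                      (trans (sumList-filter p P? f xs) (sym (+-identityˡ _)))

  length-filter≡sumList : (p : A → Bool) (P? : ∀ x → Dec (T (p x))) (xs : List A) →
                          + length (filter P? xs) ≡ sumList (λ x → ⟦ p x ⟧) xs
  length-filter≡sumList p P? []       = refl
  length-filter≡sumList p P? (x ∷ xs) with p x in px
  ... | true  = trans (cong (+_ ∘ length) (filter-accept P? (Equivalence.from T-≡ px)))
                      (cong (_+_ 1ℤ) (length-filter≡sumList p P? xs))
  ... | false = trans (cong (+_ ∘ length) (filter-reject P? (subst T px)))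
                      (trans (length-filter≡sumList p P? xs) (sym (+-identityˡ _)))

  coverCount≡sumList : (Y : List (Word n)) (x : Word n) →
                       + coverCount Y x ≡ sumList (λ v → ⟦ covers x v ⟧) Y
  coverCount≡sumList Y x = length-filter≡sumList (covers x) _ Y

  sumList-map-++ : (f : B → ℤ) (g : A → B) (xs : List A) (ys : List B) →
                   sumList f (map g xs ++ ys) ≡ sumList (f ∘ g) xs + sumList f ys
  sumList-map-++ f g []       ys = sym (+-identityˡ (sumList f ys))
  sumList-map-++ f g (x ∷ xs) ys =
    trans (cong (_+_ (f (g x))) (sumList-map-++ f g xs ys)) (sym (+-assoc (f (g x)) _ _))

  sumList-allWords : (f : Word n → ℤ) → sumList f (allWords n) ≡ sumW n f
  sumList-allWords {zero}  f = +-identityʳ (f [])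
  sumList-allWords {suc n} f =
    trans (sumList-map-++ f (𝟘 ∷_) W _) (trans (cong₂ _+_ (part 𝟘)
    (trans (sumList-map-++ f (a ∷_) W _) (cong₂ _+_ (part a)
    (trans (sumList-map-++ f (b ∷_) W _) (cong₂ _+_ (part b)
    (trans (sumList-map-++ f (c ∷_) W []) (cong (_+ 0ℤ) (part c))))))))
    (reassociate (S 𝟘) (S a) (S b) (S c)))
    where
    W : List (Word n)
    W = allWords n
    S : K → ℤ
    S x = sumW n (λ v → f (x ∷ v))
    part : ∀ x → sumList (f ∘ (x ∷_)) W ≡ S x
    part x = sumList-allWords (f ∘ (x ∷_))
    reassociate : ∀ p q r s → p + (q + (r + (s + 0ℤ))) ≡ p + q + r + s
    reassociate = solve-∀

  zeros≡∑ : (v : Word n) → + zeros v ≡ ∑[ i < n ] ⟦ isZero (lookup v i) ⟧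
  zeros≡∑ []      = refl
  zeros≡∑ (𝟘 ∷ v) = cong (_+_ 1ℤ) (zeros≡∑ v)
  zeros≡∑ (a ∷ v) = trans (zeros≡∑ v) (sym (+-identityˡ _))
  zeros≡∑ (b ∷ v) = trans (zeros≡∑ v) (sym (+-identityˡ _))
  zeros≡∑ (c ∷ v) = trans (zeros≡∑ v) (sym (+-identityˡ _))

  -- Each zero coordinate of x is either zero in v or one of the three nonzero symbols.
  coverTotal : ℕ → (ℕ → ℤ) → ℤ
  coverTotal zero    G = G 0
  coverTotal (suc r) G = coverTotal r (G ∘ suc) + + 3 * coverTotal r G

  sumW-covers : (x : Word n) (G : ℕ → ℤ) →
                sumW n (λ v → ⟦ covers x v ⟧ * G (zeros v)) ≡ coverTotal (zeros x) G
  sumW-covers []      G = *-identityˡ (G 0)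
  sumW-covers (𝟘 ∷ x) G =
    trans (cong₂ _+_ (cong₂ _+_ (cong₂ _+_ (sumW-covers x (G ∘ suc)) (sumW-covers x G)) (sumW-covers x G))
                     (sumW-covers x G))
          (triple (coverTotal (zeros x) (G ∘ suc)) (coverTotal (zeros x) G))
    where
    triple : ∀ p q → p + q + q + q ≡ p + + 3 * q
    triple = solve-∀
  sumW-covers {suc n} (a ∷ x) G =
    trans (cong₂ _+_ (cong₂ _+_ (cong₂ _+_ (sumW-zero {n}) (sumW-covers x G)) (sumW-zero {n})) (sumW-zero {n}))
          (second (coverTotal (zeros x) G))
    where
    second : ∀ p → 0ℤ + p + 0ℤ + 0ℤ ≡ p
    second = solve-∀
  sumW-covers {suc n} (b ∷ x) G =
    trans (cong₂ _+_ (cong₂ _+_ (cong₂ _+_ (sumW-zero {n}) (sumW-zero {n})) (sumW-covers x G)) (sumW-zero {n}))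
          (third (coverTotal (zeros x) G))
    where
    third : ∀ p → 0ℤ + 0ℤ + p + 0ℤ ≡ p
    third = solve-∀
  sumW-covers {suc n} (c ∷ x) G =
    trans (cong₂ _+_ (cong₂ _+_ (cong₂ _+_ (sumW-zero {n}) (sumW-zero {n})) (sumW-zero {n})) (sumW-covers x G))
          (fourth (coverTotal (zeros x) G))
    where
    fourth : ∀ p → 0ℤ + 0ℤ + 0ℤ + p ≡ p
    fourth = solve-∀

module Fourier where

  open Sums
  open import Data.Integer using (ℤ; +_; -_; _+_; _*_; 0ℤ; 1ℤ; +0; +[1+_]; -[1+_])
  open import Data.Integer.Properties using (*-identityˡ; *-identityʳ; *-comm; *-assoc; pos-*)
  open import Data.Integer.Tactic.RingSolver using (solve-∀)
  open ≡-Reasoning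

  sgn : Bool → ℤ
  sgn false = 1ℤ
  sgn true  = - 1ℤ

  sgn-xor : ∀ p q → sgn (p xor q) ≡ sgn p * sgn q
  sgn-xor false false = refl
  sgn-xor false true  = refl
  sgn-xor true  false = refl
  sgn-xor true  true  = refl

  χ : Word n → Word n → ℤ
  χ u v = sgn (ip u v)

  χ-homo : (u w v : Word n) → χ u (w ⊕ᵥ v) ≡ χ u w * χ u v
  χ-homo u w v = trans (cong sgn (ip-distribˡ-⊕ᵥ u w v)) (sgn-xor (ip u w) (ip u v))

  δ : Word n → ℤ
  δ []      = 1ℤ
  δ (x ∷ v) = ⟦ isZero x ⟧ * δ v

  δ-zeroW : δ (zeroW {n}) ≡ 1ℤ
  δ-zeroW {zero}  = refl
  δ-zeroW {suc n} rewrite δ-zeroW {n} = refl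

  δ-nonzero : (v : Word n) → v ≢ zeroW → δ v ≡ 0ℤ
  δ-nonzero []      []≢0 = ⊥-elim ([]≢0 refl)
  δ-nonzero (𝟘 ∷ v) v≢0 rewrite δ-nonzero v (v≢0 ∘ cong (𝟘 ∷_)) = refl
  δ-nonzero (a ∷ v) _   = refl
  δ-nonzero (b ∷ v) _   = refl
  δ-nonzero (c ∷ v) _   = refl

  sumK-sgn : ∀ y → sumK (λ x → sgn (x · y)) ≡ + 4 * ⟦ isZero y ⟧
  sumK-sgn 𝟘 = refl
  sumK-sgn a = refl
  sumK-sgn b = refl
  sumK-sgn c = refl

  character-sum : (y : Word n) → sumW n (λ u → χ u y) ≡ + (4 ℕ.^ n) * δ y
  character-sum {zero}  []       = refl
  character-sum {suc n} (y₀ ∷ y) = begin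
    sumK (λ x → sumW n (λ u → sgn ((x · y₀) xor ip u y)))
      ≡⟨ sumK-cong (λ x → trans (sumW-cong (λ u → sgn-xor (x · y₀) (ip u y)))
                                 (sym (*-distribˡ-sumW (sgn (x · y₀)) (λ u → χ u y)))) ⟩
    sumK (λ x → sgn (x · y₀) * sumW n (λ u → χ u y))
      ≡⟨ sumK-cong (λ x → *-comm (sgn (x · y₀)) (sumW n (λ u → χ u y))) ⟩
    sumK (λ x → sumW n (λ u → χ u y) * sgn (x · y₀))
      ≡⟨ *-distribˡ-sumK (sumW n (λ u → χ u y)) (λ x → sgn (x · y₀)) ⟨
    sumW n (λ u → χ u y) * sumK (λ x → sgn (x · y₀))
      ≡⟨ cong₂ _*_ (character-sum y) (sumK-sgn y₀) ⟩
    + (4 ℕ.^ n) * δ y * (+ 4 * ⟦ isZero y₀ ⟧)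
      ≡⟨ regroup (+ (4 ℕ.^ n)) (δ y) (+ 4) ⟦ isZero y₀ ⟧ ⟩
    + 4 * + (4 ℕ.^ n) * (⟦ isZero y₀ ⟧ * δ y)
      ≡⟨ cong (_* δ (y₀ ∷ y)) (pos-* 4 (4 ℕ.^ n)) ⟨
    + (4 ℕ.^ suc n) * δ (y₀ ∷ y) ∎
    where
    regroup : ∀ p q r s → p * q * (r * s) ≡ r * p * (s * q)
    regroup = solve-∀

  hat : (Word n → ℤ) → Word n → ℤ
  hat {n} F u = sumW n (λ w → F w * χ u w)

  hat-zeroW : (F : Word n → ℤ) → hat F zeroW ≡ sumW n F
  hat-zeroW F = sumW-cong (λ w → trans (cong (λ p → F w * sgn p) (ip-zeroˡ w)) (*-identityʳ (F w)))

  sumW-δ : (h : Word n → ℤ) (v : Word n) → sumW n (λ w → δ (w ⊕ᵥ v) * h w) ≡ h v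
  sumW-δ {n} h v = begin
    sumW n (λ w → δ (w ⊕ᵥ v) * h w)
      ≡⟨ sumW-translate (λ w → δ (w ⊕ᵥ v) * h w) v ⟨
    sumW n (λ w → δ ((w ⊕ᵥ v) ⊕ᵥ v) * h (w ⊕ᵥ v))
      ≡⟨ sumW-cong (λ w → cong (λ t → δ t * h (w ⊕ᵥ v)) (x⊕ᵥy⊕ᵥy≡x w v)) ⟩
    sumW n (λ w → δ w * h (w ⊕ᵥ v))
      ≡⟨ sumW-concentrated (λ w → δ w * h (w ⊕ᵥ v))
                           (λ w w≢0 → cong (_* h (w ⊕ᵥ v)) (δ-nonzero w w≢0)) ⟩
    δ (zeroW {n}) * h (zeroW ⊕ᵥ v)
      ≡⟨ cong₂ _*_ (δ-zeroW {n}) (cong h (⊕ᵥ-identityˡ v)) ⟩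
    1ℤ * h v
      ≡⟨ *-identityˡ (h v) ⟩
    h v ∎

  fourier-inversion : (F : Word n → ℤ) (v : Word n) →
                      sumW n (λ u → hat F u * χ u v) ≡ + (4 ℕ.^ n) * F v
  fourier-inversion {n} F v = begin
    sumW n (λ u → hat F u * χ u v)
      ≡⟨ sumW-cong (λ u → trans (*-distribʳ-sumW (χ u v) (λ w → F w * χ u w))
                                (sumW-cong (λ w → merge u w))) ⟩
    sumW n (λ u → sumW n (λ w → F w * χ u (w ⊕ᵥ v)))
      ≡⟨ sumW-comm n (λ u w → F w * χ u (w ⊕ᵥ v)) ⟩
    sumW n (λ w → sumW n (λ u → F w * χ u (w ⊕ᵥ v)))
      ≡⟨ sumW-cong (λ w → trans (sym (*-distribˡ-sumW (F w) (λ u → χ u (w ⊕ᵥ v))))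
                                (cong (F w *_) (character-sum (w ⊕ᵥ v)))) ⟩
    sumW n (λ w → F w * (+ (4 ℕ.^ n) * δ (w ⊕ᵥ v)))
      ≡⟨ sumW-cong (λ w → rotate (F w) (+ (4 ℕ.^ n)) (δ (w ⊕ᵥ v))) ⟩
    sumW n (λ w → + (4 ℕ.^ n) * (δ (w ⊕ᵥ v) * F w))
      ≡⟨ *-distribˡ-sumW (+ (4 ℕ.^ n)) (λ w → δ (w ⊕ᵥ v) * F w) ⟨
    + (4 ℕ.^ n) * sumW n (λ w → δ (w ⊕ᵥ v) * F w)
      ≡⟨ cong (+ (4 ℕ.^ n) *_) (sumW-δ F v) ⟩
    + (4 ℕ.^ n) * F v ∎
    where
    rotate : ∀ p q r → p * (q * r) ≡ q * (r * p)
    rotate = solve-∀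
    merge : ∀ u w → F w * χ u w * χ u v ≡ F w * χ u (w ⊕ᵥ v)
    merge u w = trans (*-assoc (F w) (χ u w) (χ u v)) (cong (F w *_) (sym (χ-homo u w v)))

  plancherel : (F G : Word n → ℤ) →
               + (4 ℕ.^ n) * sumW n (λ v → G v * F v) ≡ sumW n (λ u → hat F u * hat G u)
  plancherel {n} F G = begin
    + (4 ℕ.^ n) * sumW n (λ v → G v * F v)
      ≡⟨ *-distribˡ-sumW (+ (4 ℕ.^ n)) (λ v → G v * F v) ⟩
    sumW n (λ v → + (4 ℕ.^ n) * (G v * F v))
      ≡⟨ sumW-cong (λ v → trans (swap (+ (4 ℕ.^ n)) (G v) (F v))
                                (cong (G v *_) (sym (fourier-inversion F v)))) ⟩
    sumW n (λ v → G v * sumW n (λ u → hat F u * χ u v))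
      ≡⟨ sumW-cong (λ v → trans (*-distribˡ-sumW (G v) (λ u → hat F u * χ u v))
                                (sumW-cong (λ u → swap (G v) (hat F u) (χ u v)))) ⟩
    sumW n (λ v → sumW n (λ u → hat F u * (G v * χ u v)))
      ≡⟨ sumW-comm n (λ v u → hat F u * (G v * χ u v)) ⟩
    sumW n (λ u → sumW n (λ v → hat F u * (G v * χ u v)))
      ≡⟨ sumW-cong (λ u → sym (*-distribˡ-sumW (hat F u) (λ v → G v * χ u v))) ⟩
    sumW n (λ u → hat F u * hat G u) ∎
    where
    swap : ∀ p q r → p * (q * r) ≡ q * (p * r)
    swap = solve-∀

  i≡-i⇒i≡0 : ∀ i → i ≡ - i → i ≡ 0ℤ
  i≡-i⇒i≡0 +0       _  = refl
  i≡-i⇒i≡0 +[1+ _ ] ()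
  i≡-i⇒i≡0 -[1+ _ ] ()

  hat-vanishes-periodic : {F : Word n → ℤ} (e u : Word n) →
                          (∀ v → F (v ⊕ᵥ e) ≡ F v) → ip u e ≡ true → hat F u ≡ 0ℤ
  hat-vanishes-periodic {n} {F} e u periodic ue≡1 = i≡-i⇒i≡0 (hat F u) (begin
    hat F u                                     ≡⟨ sumW-translate (λ w → F w * χ u w) e ⟨
    sumW n (λ w → F (w ⊕ᵥ e) * χ u (w ⊕ᵥ e))    ≡⟨ sumW-cong flip ⟩
    sumW n (λ w → - (F w * χ u w))              ≡⟨ sumW-neg (λ w → F w * χ u w) ⟩
    - hat F u                                   ∎)
    where
    negate : ∀ p q → p * (q * - 1ℤ) ≡ - (p * q)
    negate = solve-∀
    flip : ∀ w → F (w ⊕ᵥ e) * χ u (w ⊕ᵥ e) ≡ - (F w * χ u w)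
    flip w = trans (cong₂ _*_ (periodic w) (trans (χ-homo u w e) (cong (λ p → χ u w * sgn p) ue≡1)))
                   (negate (F w) (χ u w))

  hat-support : {S : Subset n} {F : Word n → ℤ} (u : Word n) →
                DependsOn S F → hat F u ≢ 0ℤ → support u ⊆ S
  hat-support {S = S} u dep hat≢0 {i} i∈u = decidable-stable (i ∈? S) λ i∉S →
    let y , uᵢ·y≡1 = ·-nondegenerate (lookup u i) (∈-support u i∈u)
    in  hat≢0 (hat-vanishes-periodic (zeroW [ i ]≔ y) u
                 (λ v → dep v _ (single-vanishesOn y i∉S)) (trans (ip-single u i y) uᵢ·y≡1))

module Polynomials where

  open import Data.Integer using (ℤ; +_; _-_; _*_; 0ℤ; 1ℤ)
  open import Data.Integer.Properties
    using (+-injective; +-inverseʳ; *-zeroʳ; i-j≡0⇒i≡j; i*j≡0⇒i≡0∨j≡0)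
  open import Data.List.Relation.Unary.All using (All; []; _∷_)

  rootProduct : List ℕ → ℕ → ℤ
  rootProduct []       y = 1ℤ
  rootProduct (q ∷ qs) y = (+ y - + q) * rootProduct qs y

  rootProduct-root : {q : ℕ} {qs : List ℕ} → q ∈ qs → rootProduct qs q ≡ 0ℤ
  rootProduct-root {q} {q ∷ qs} (here refl) = cong (_* rootProduct qs q) (+-inverseʳ (+ q))
  rootProduct-root {q} {q′ ∷ qs} (there q∈qs) =
    trans (cong ((+ q - + q′) *_) (rootProduct-root q∈qs)) (*-zeroʳ (+ q - + q′))

  rootProduct-nonzero : {y : ℕ} {qs : List ℕ} → All (_≢ y) qs → rootProduct qs y ≢ 0ℤ
  rootProduct-nonzero []                 ()
  rootProduct-nonzero {y} {q ∷ qs} (q≢y ∷ qs≢y) eq with i*j≡0⇒i≡0∨j≡0 (+ y - + q) eq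
  ... | inj₁ y-q≡0 = q≢y (sym (+-injective (i-j≡0⇒i≡j (+ y) (+ q) y-q≡0)))
  ... | inj₂ rest≡0 = rootProduct-nonzero qs≢y rest≡0

module Codes {n : ℕ} (C : Code n) where

  open Sums
  open Fourier
  open Polynomials
  open import Data.Integer using (ℤ; +_; -_; _+_; _-_; _*_; 0ℤ; 1ℤ; ≢-nonZero)
  open import Data.Integer.Properties
    using (_≟_; *-identityˡ; *-identityʳ; *-zeroʳ; *-comm; *-distribˡ-+; *-cancelˡ-≡; +-*-semiring)
  open import Data.Integer.Tactic.RingSolver using (solve-∀)
  open import Algebra.Properties.Semiring.Sum +-*-semiring using (sum-syntax; sum-cong-≗; *-distribʳ-sum)
  open import Data.Fin.Subset.Properties using (∣⁅x⁆∣≡1)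
  open import Data.List using (length; filter)
  open import Data.List.Membership.Propositional.Properties using (∈-filter⁺; ∈-filter⁻)
  open import Data.List.Properties using (filter-notAll; filter-some)
  open import Data.Bool.Properties using (T-∧)
  open import Data.List.Relation.Unary.All.Properties using (all-filter)
  open import Relation.Nullary using (yes; no; ¬?; contradiction)
  open import Relation.Nullary.Decidable using (⌊_⌋; isYes≗does; does-⇔; toWitness; fromWitness)
  open ≡-Reasoning

  𝟙C : Word n → ℤ
  𝟙C v = ⟦ mem C v ⟧

  coverSum : Word n → (ℕ → ℤ) → ℤ
  coverSum x G = sumW n (λ v → 𝟙C v * (⟦ covers x v ⟧ * G (zeros v)))

  sumList-codewordsOfWeight : (w : ℕ) (f : Word n → ℤ) →
    sumList f (codewordsOfWeight C w) ≡ sumW n (λ v → ⟦ mem C v ∧ ⌊ wt v ℕ.≟ w ⌋ ⟧ * f v)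
  sumList-codewordsOfWeight w f =
    trans (sumList-filter (λ v → mem C v ∧ ⌊ wt v ℕ.≟ w ⌋) _ f (allWords n))
          (sumList-allWords (λ v → ⟦ mem C v ∧ ⌊ wt v ℕ.≟ w ⌋ ⟧ * f v))

  codewordsOfWeight-nonempty : (v : Word n) → v ∈C C → 0 < length (codewordsOfWeight C (wt v))
  codewordsOfWeight-nonempty v v∈C =
    filter-some _ {xs = allWords n}
      (Any.map (λ v≡u → subst (λ u → T (mem C u ∧ ⌊ wt u ℕ.≟ wt v ⌋)) v≡u v-selected)
               (∈-allWords v))
    where
    v-selected : T (mem C v ∧ ⌊ wt v ℕ.≟ wt v ⌋)
    v-selected = Equivalence.from T-∧ (Equivalence.from T-≡ v∈C , fromWitness refl)

  codewordsOfWeight-wt : {w : ℕ} {v : Word n} → v ∈ codewordsOfWeight C w → wt v ≡ w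
  codewordsOfWeight-wt {v = v} v∈ =
    toWitness (proj₂ (Equivalence.to (T-∧ {mem C v}) (proj₂ (∈-filter⁻ _ {xs = allWords n} v∈))))

  coverCount≡coverSum : (x x₀ : Word n) →
    + coverCount (codewordsOfWeight C (wt x₀)) x ≡ coverSum x (λ z → ⟦ ⌊ z ℕ.≟ zeros x₀ ⌋ ⟧)
  coverCount≡coverSum x x₀ =
    trans (coverCount≡sumList (codewordsOfWeight C (wt x₀)) x)
    (trans (sumList-codewordsOfWeight (wt x₀) (λ v → ⟦ covers x v ⟧))
           (sumW-cong (λ v → trans (cong (λ t → ⟦ mem C v ∧ t ⟧ * _) (same-weight v)) (regroup v))))
    where
    same-weight : ∀ v → ⌊ wt v ℕ.≟ wt x₀ ⌋ ≡ ⌊ zeros v ℕ.≟ zeros x₀ ⌋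
    same-weight v = trans (isYes≗does (wt v ℕ.≟ wt x₀)) (trans
      (does-⇔ (mk⇔ (zeros-cong-wt v x₀) (wt-cong-zeros v x₀))
              (wt v ℕ.≟ wt x₀) (zeros v ℕ.≟ zeros x₀))
      (sym (isYes≗does (zeros v ℕ.≟ zeros x₀))))
    reorder : ∀ p q r → p * q * r ≡ p * (r * q)
    reorder = solve-∀
    regroup : ∀ v → ⟦ mem C v ∧ ⌊ zeros v ℕ.≟ zeros x₀ ⌋ ⟧ * ⟦ covers x v ⟧
                    ≡ 𝟙C v * (⟦ covers x v ⟧ * ⟦ ⌊ zeros v ℕ.≟ zeros x₀ ⌋ ⟧)
    regroup v = trans (cong (_* _) (⟦∧⟧ (mem C v) _)) (reorder (𝟙C v) _ ⟦ covers x v ⟧)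

  mem-translate : {w : Word n} → w ∈C C → ∀ v → mem C (v ⊕ᵥ w) ≡ mem C v
  mem-translate {w} w∈C v with mem C v in v∈C
  ... | true  = add-mem C v w v∈C w∈C
  ... | false with mem C (v ⊕ᵥ w) in v⊕w∈C
  ...   | false = refl
  ...   | true  = contradiction (trans (sym v∈C′) v∈C) λ ()
    where
    v∈C′ : mem C v ≡ true
    v∈C′ = trans (cong (mem C) (sym (x⊕ᵥy⊕ᵥy≡x v w))) (add-mem C (v ⊕ᵥ w) w v⊕w∈C w∈C)

  -- No codeword y with ip u y ≡ true can be exhibited constructively; instead, a nonzero
  -- transform forces u to be orthogonal to every codeword.
  hat-𝟙C-vanishes : SelfDual C → (u : Word n) → ¬ (u ∈C C) → hat 𝟙C u ≡ 0ℤ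
  hat-𝟙C-vanishes selfDual u u∉C with hat 𝟙C u ≟ 0ℤ
  ... | yes hat≡0 = hat≡0
  ... | no  hat≢0 = contradiction (Equivalence.from (selfDual u) orthogonal) u∉C
    where
    orthogonal : ∀ y → y ∈C C → ip u y ≡ false
    orthogonal y y∈C with ip u y in uy
    ... | false = refl
    ... | true  =
      contradiction (hat-vanishes-periodic y u (λ v → cong ⟦_⟧ (mem-translate y∈C v)) uy) hat≢0

  module OrthogonalArray (selfDual : SelfDual C) {d : ℕ}
                         (minDist : ∀ x → x ∈C C → x ≢ zeroW → d ≤ wt x) where

    Unbiased : (Word n → ℤ) → Set
    Unbiased F = + (4 ℕ.^ n) * sumW n (λ v → 𝟙C v * F v) ≡ sumW n 𝟙C * sumW n F

    dependsOn-unbiased : {S : Subset n} {F : Word n → ℤ} → DependsOn S F → ∣ S ∣ < d → Unbiased F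
    dependsOn-unbiased {S} {F} dep ∣S∣<d = begin
      + (4 ℕ.^ n) * sumW n (λ v → 𝟙C v * F v) ≡⟨ plancherel F 𝟙C ⟩
      sumW n (λ u → hat F u * hat 𝟙C u)       ≡⟨ sumW-concentrated _ off-zero ⟩
      hat F zeroW * hat 𝟙C zeroW              ≡⟨ cong₂ _*_ (hat-zeroW F) (hat-zeroW 𝟙C) ⟩
      sumW n F * sumW n 𝟙C                    ≡⟨ *-comm (sumW n F) (sumW n 𝟙C) ⟩
      sumW n 𝟙C * sumW n F                    ∎
      where
      -- Either hat F u ≡ 0ℤ, or u is supported in S, hence has weight < d, hence is not in C.
      off-zero : ∀ u → u ≢ zeroW → hat F u * hat 𝟙C u ≡ 0ℤ
      off-zero u u≢0 with hat F u ≟ 0ℤ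
      ... | yes hatF≡0 = cong (_* hat 𝟙C u) hatF≡0
      ... | no  hatF≢0 = trans (cong (hat F u *_) (hat-𝟙C-vanishes selfDual u u∉C)) (*-zeroʳ (hat F u))
        where
        wt≤∣S∣ : wt u ≤ ∣ S ∣
        wt≤∣S∣ = subst (_≤ ∣ S ∣) (sym (wt≡∣support∣ u))
                       (p⊆q⇒∣p∣≤∣q∣ (hat-support u dep hatF≢0))
        u∉C : ¬ (u ∈C C)
        u∉C u∈C =
          ℕ.<-irrefl refl (ℕ.≤-<-trans (ℕ.≤-trans (minDist u u∈C u≢0) wt≤∣S∣) ∣S∣<d)

    unbiased-cong : {F G : Word n → ℤ} → (∀ v → F v ≡ G v) → Unbiased F → Unbiased G
    unbiased-cong F≗G unbiased =
      trans (cong (+ (4 ℕ.^ n) *_) (sumW-cong (λ v → cong (𝟙C v *_) (sym (F≗G v)))))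
            (trans unbiased (cong (sumW n 𝟙C *_) (sumW-cong F≗G)))

    unbiased-zero : Unbiased (λ _ → 0ℤ)
    unbiased-zero = begin
      + (4 ℕ.^ n) * sumW n (λ v → 𝟙C v * 0ℤ) ≡⟨ cong (+ (4 ℕ.^ n) *_) (sumW-cong (*-zeroʳ ∘ 𝟙C)) ⟩
      + (4 ℕ.^ n) * sumW n (λ _ → 0ℤ)        ≡⟨ cong (+ (4 ℕ.^ n) *_) (sumW-zero {n}) ⟩
      + (4 ℕ.^ n) * 0ℤ                       ≡⟨ *-zeroʳ (+ (4 ℕ.^ n)) ⟩
      0ℤ                                     ≡⟨ *-zeroʳ (sumW n 𝟙C) ⟨
      sumW n 𝟙C * 0ℤ                         ≡⟨ cong (sumW n 𝟙C *_) (sumW-zero {n}) ⟨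
      sumW n 𝟙C * sumW n (λ _ → 0ℤ)          ∎

    unbiased-+ : {F G : Word n → ℤ} → Unbiased F → Unbiased G → Unbiased (λ v → F v + G v)
    unbiased-+ {F} {G} unbiasedF unbiasedG = begin
      + (4 ℕ.^ n) * sumW n (λ v → 𝟙C v * (F v + G v))
        ≡⟨ cong (+ (4 ℕ.^ n) *_) (trans (sumW-cong (λ v → *-distribˡ-+ (𝟙C v) (F v) (G v)))
                                         (sumW-distrib-+ (λ v → 𝟙C v * F v) (λ v → 𝟙C v * G v))) ⟩
      + (4 ℕ.^ n) * (sumW n (λ v → 𝟙C v * F v) + sumW n (λ v → 𝟙C v * G v))
        ≡⟨ *-distribˡ-+ (+ (4 ℕ.^ n)) _ _ ⟩
      + (4 ℕ.^ n) * sumW n (λ v → 𝟙C v * F v) + + (4 ℕ.^ n) * sumW n (λ v → 𝟙C v * G v)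
        ≡⟨ cong₂ _+_ unbiasedF unbiasedG ⟩
      sumW n 𝟙C * sumW n F + sumW n 𝟙C * sumW n G
        ≡⟨ *-distribˡ-+ (sumW n 𝟙C) _ _ ⟨
      sumW n 𝟙C * (sumW n F + sumW n G)
        ≡⟨ cong (sumW n 𝟙C *_) (sumW-distrib-+ F G) ⟨
      sumW n 𝟙C * sumW n (λ v → F v + G v) ∎

    unbiased-*ˡ : {F : Word n → ℤ} (s : ℤ) → Unbiased F → Unbiased (λ v → s * F v)
    unbiased-*ˡ {F} s unbiased = begin
      + (4 ℕ.^ n) * sumW n (λ v → 𝟙C v * (s * F v))
        ≡⟨ cong (+ (4 ℕ.^ n) *_) (trans (sumW-cong (λ v → swap (𝟙C v) s (F v)))
                                         (sym (*-distribˡ-sumW s (λ v → 𝟙C v * F v)))) ⟩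
      + (4 ℕ.^ n) * (s * sumW n (λ v → 𝟙C v * F v))
        ≡⟨ swap (+ (4 ℕ.^ n)) s _ ⟩
      s * (+ (4 ℕ.^ n) * sumW n (λ v → 𝟙C v * F v))
        ≡⟨ cong (s *_) unbiased ⟩
      s * (sumW n 𝟙C * sumW n F)
        ≡⟨ swap s (sumW n 𝟙C) (sumW n F) ⟩
      sumW n 𝟙C * (s * sumW n F)
        ≡⟨ cong (sumW n 𝟙C *_) (*-distribˡ-sumW s F) ⟩
      sumW n 𝟙C * sumW n (λ v → s * F v) ∎
      where
      swap : ∀ p q r → p * (q * r) ≡ q * (p * r)
      swap = solve-∀

    unbiased-∑ : ∀ m {F : Fin m → Word n → ℤ} →
                 (∀ i → Unbiased (F i)) → Unbiased (λ v → ∑[ i < m ] F i v)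
    unbiased-∑ zero    _          = unbiased-zero
    unbiased-∑ (suc m) unbiasedFᵢ = unbiased-+ (unbiasedFᵢ zero) (unbiased-∑ m (unbiasedFᵢ ∘ suc))

    unbiased-rootProduct : (L : List ℕ) {S : Subset n} {F : Word n → ℤ} → DependsOn S F →
                           ∣ S ∣ ℕ.+ length L < d → Unbiased (λ v → rootProduct L (zeros v) * F v)
    unbiased-rootProduct []      dep bound =
      unbiased-cong (λ v → sym (*-identityˡ _))
                    (dependsOn-unbiased dep (subst (_< d) (ℕ.+-identityʳ _) bound))
    unbiased-rootProduct (q ∷ L) {S} {F} dep bound =
      unbiased-cong expand
        (unbiased-+ (unbiased-∑ n (λ i → unbiased-rootProduct L (zeroAt-dependsOn i) (bound-at i)))
                    (unbiased-*ˡ (- + q) (unbiased-rootProduct L dep bound′)))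
      where
      R : Word n → ℤ
      R v = rootProduct L (zeros v)
      zeroAt : Fin n → Word n → ℤ
      zeroAt i v = ⟦ isZero (lookup v i) ⟧
      zeroAt-dependsOn : ∀ i → DependsOn (⁅ i ⁆ ∪ S) (λ v → zeroAt i v * F v)
      zeroAt-dependsOn i = dependsOn-∪ _*_ (dependsOn-∘ (⟦_⟧ ∘ isZero) (lookup-dependsOn i)) dep
      bound′ : ∣ S ∣ ℕ.+ length L < d
      bound′ = ℕ.≤-<-trans (ℕ.+-monoʳ-≤ ∣ S ∣ (ℕ.n≤1+n (length L))) bound
      bound-at : ∀ i → ∣ ⁅ i ⁆ ∪ S ∣ ℕ.+ length L < d
      bound-at i = ℕ.≤-<-trans (ℕ.+-monoˡ-≤ (length L) ∣⁅i⁆∪S∣≤1+∣S∣)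
                               (subst (_< d) (ℕ.+-suc ∣ S ∣ (length L)) bound)
        where
        ∣⁅i⁆∪S∣≤1+∣S∣ : ∣ ⁅ i ⁆ ∪ S ∣ ≤ suc ∣ S ∣
        ∣⁅i⁆∪S∣≤1+∣S∣ =
          subst (∣ ⁅ i ⁆ ∪ S ∣ ≤_) (cong (ℕ._+ ∣ S ∣) (∣⁅x⁆∣≡1 i)) (∣p∪q∣≤∣p∣+∣q∣ ⁅ i ⁆ S)
      swap : ∀ p q r → p * (q * r) ≡ q * (p * r)
      swap = solve-∀
      factor : ∀ z q r f → z * (r * f) + - q * (r * f) ≡ (z - q) * r * f
      factor = solve-∀
      expand : ∀ v → ∑[ i < n ] (R v * (zeroAt i v * F v)) + - + q * (R v * F v)
                     ≡ (+ zeros v - + q) * R v * F v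
      expand v = begin
        ∑[ i < n ] (R v * (zeroAt i v * F v)) + - + q * (R v * F v)
          ≡⟨ cong (_+ - + q * (R v * F v)) (sum-cong-≗ (λ i → swap (R v) (zeroAt i v) (F v))) ⟩
        ∑[ i < n ] (zeroAt i v * (R v * F v)) + - + q * (R v * F v)
          ≡⟨ cong (_+ - + q * (R v * F v)) (*-distribʳ-sum (R v * F v) (λ i → zeroAt i v)) ⟨
        ∑[ i < n ] zeroAt i v * (R v * F v) + - + q * (R v * F v)
          ≡⟨ cong (λ z → z * (R v * F v) + - + q * (R v * F v)) (zeros≡∑ v) ⟨
        + zeros v * (R v * F v) + - + q * (R v * F v)
          ≡⟨ factor (+ zeros v) (+ q) (R v) (F v) ⟩
        (+ zeros v - + q) * R v * F v ∎

    coverSum-rootProduct : (x : Word n) (L : List ℕ) → wt x ℕ.+ length L < d →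
      + (4 ℕ.^ n) * coverSum x (rootProduct L) ≡ sumW n 𝟙C * coverTotal (zeros x) (rootProduct L)
    coverSum-rootProduct x L bound =
      trans (unbiased-cong (λ v → *-comm (rootProduct L (zeros v)) ⟦ covers x v ⟧)
                           (unbiased-rootProduct L (dependsOn-∘ ⟦_⟧ (covers-dependsOn x))
                              (subst (λ w → w ℕ.+ length L < d) (wt≡∣support∣ x) bound)))
            (cong (sumW n 𝟙C *_) (sumW-covers x (rootProduct L)))

    coverSum-uniform : (x x′ : Word n) (L : List ℕ) → wt x ≡ wt x′ → wt x ℕ.+ length L < d →
                       coverSum x (rootProduct L) ≡ coverSum x′ (rootProduct L)
    coverSum-uniform x x′ L wt≡ bound = *-cancelˡ-≡ (+ (4 ℕ.^ n)) _ _ {{ℕ.m^n≢0 4 n}} (begin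
      + (4 ℕ.^ n) * coverSum x (rootProduct L)
        ≡⟨ coverSum-rootProduct x L bound ⟩
      sumW n 𝟙C * coverTotal (zeros x) (rootProduct L)
        ≡⟨ cong (λ z → sumW n 𝟙C * coverTotal z (rootProduct L)) (zeros-cong-wt x x′ wt≡) ⟩
      sumW n 𝟙C * coverTotal (zeros x′) (rootProduct L)
        ≡⟨ coverSum-rootProduct x′ L (subst (λ w → w ℕ.+ length L < d) wt≡ bound) ⟨
      + (4 ℕ.^ n) * coverSum x′ (rootProduct L) ∎)

    coverSum-indicator-uniform :
      (L : List ℕ) → (∀ v → v ∈C C → v ≢ zeroW → zeros v ∈ L) → {y : ℕ} → y ∈ L →
      (x x′ : Word n) → wt x ≡ wt x′ → 1 ≤ wt x → wt x ℕ.+ length L ≤ d →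
      coverSum x (λ z → ⟦ ⌊ z ℕ.≟ y ⌋ ⟧) ≡ coverSum x′ (λ z → ⟦ ⌊ z ℕ.≟ y ⌋ ⟧)
    coverSum-indicator-uniform L zeros∈L {y} y∈L x x′ wt≡ 1≤wt bound =
      *-cancelˡ-≡ (p y) _ _ {{≢-nonZero (rootProduct-nonzero (all-filter ≢y? L))}} (begin
        p y * coverSum x δy   ≡⟨ sifts x 1≤wt ⟨
        coverSum x p          ≡⟨ coverSum-uniform x x′ L′ wt≡ bound′ ⟩
        coverSum x′ p         ≡⟨ sifts x′ (subst (1 ≤_) wt≡ 1≤wt) ⟩
        p y * coverSum x′ δy  ∎)
      where
      -- p vanishes at every value of zeros v on nonzero codewords except y.
      ≢y? : (q : ℕ) → Dec (q ≢ y)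
      ≢y? q = ¬? (q ℕ.≟ y)
      L′ : List ℕ
      L′ = filter ≢y? L
      p : ℕ → ℤ
      p = rootProduct L′
      δy : ℕ → ℤ
      δy z = ⟦ ⌊ z ℕ.≟ y ⌋ ⟧
      bound′ : wt x ℕ.+ length L′ < d
      bound′ = ℕ.<-≤-trans
        (ℕ.+-monoʳ-< (wt x) (filter-notAll ≢y? L (Any.map (λ y≡q q≢y → q≢y (sym y≡q)) y∈L)))
        bound
      sift : ∀ x → 1 ≤ wt x → ∀ v →
             𝟙C v * (⟦ covers x v ⟧ * p (zeros v)) ≡ p y * (𝟙C v * (⟦ covers x v ⟧ * δy (zeros v)))
      sift x 1≤wt v with mem C v in v∈C | covers x v in v-covers-x
      ... | false | _     = sym (*-zeroʳ (p y))
      ... | true  | false = sym (*-zeroʳ (p y))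
      ... | true  | true with zeros v ℕ.≟ y
      ...   | yes refl = trans (*-identityˡ _) (trans (*-identityˡ _) (sym (*-identityʳ _)))
      ...   | no  z≢y  =
        trans (cong (λ t → 1ℤ * (1ℤ * t))
                    (rootProduct-root (∈-filter⁺ ≢y? (zeros∈L v v∈C v≢0) z≢y)))
              (sym (*-zeroʳ (p y)))
        where
        v≢0 : v ≢ zeroW
        v≢0 v≡0 = contradiction
          (subst (1 ≤_) (covers-zeroW x (subst (λ u → covers x u ≡ true) v≡0 v-covers-x)) 1≤wt) λ ()
      sifts : ∀ x → 1 ≤ wt x → coverSum x p ≡ p y * coverSum x δy
      sifts x 1≤wt = trans (sumW-cong (sift x 1≤wt))
                           (sym (*-distribˡ-sumW (p y) (λ v → 𝟙C v * (⟦ covers x v ⟧ * δy (zeros v)))))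

open import Data.Nat using (_+_; _*_)
open import Data.Nat.Divisibility using (_∣_; divides; ∣m+n∣m⇒∣n)
open import Data.Nat.DivMod using (_/_; m*n/n≡m)
open import Data.Nat.Tactic.RingSolver using (solve-∀)
open import Data.List using (applyUpTo; length)
open import Data.List.Membership.Propositional.Properties using (∈-applyUpTo⁺)
open import Data.List.Properties using (length-applyUpTo)
open import Data.Integer using (ℤ)
open import Data.Integer.Properties using (+-injective)
open import Relation.Nullary using (contradiction)
open import Relation.Nullary.Decidable using (⌊_⌋)
open Sums using (⟦_⟧)
open Codes using (coverSum; coverCount≡coverSum; codewordsOfWeight-nonempty; codewordsOfWeight-wt)
open Codes.OrthogonalArray using (coverSum-indicator-uniform)

6k/6≡k : ∀ k → 6 * k / 6 ≡ k
6k/6≡k k = trans (cong (_/ 6) (ℕ.*-comm 6 k)) (m*n/n≡m k 6)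

zeros-of-extremal-codeword : {k : ℕ} {C : Code (6 * k)} → Extremal C →
                             (v : Word (6 * k)) → v ∈C C → v ≢ zeroW → zeros v ∈ applyUpTo (2 *_) (2 * k)
zeros-of-extremal-codeword {k} (_ , even , minWeight , _) v v∈C v≢0 =
  listed (∣m+n∣m⇒∣n (subst (2 ∣_) (sym (wt+zeros v)) (divides (3 * k) (six≡3*2 k))) (even v v∈C))
  where
  open ℕ.≤-Reasoning
  six≡3*2 : ∀ k → 6 * k ≡ 3 * k * 2
  six≡3*2 = solve-∀
  six≡2+4 : ∀ k → 6 * k ≡ 2 * k + 2 * k * 2
  six≡2+4 = solve-∀
  d≤wt : 2 * k + 2 ≤ wt v
  d≤wt = subst (λ m → 2 * m + 2 ≤ wt v) (6k/6≡k k) (minWeight v v∈C v≢0)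
  zeros<4k : zeros v < 2 * k * 2
  zeros<4k = ℕ.+-cancelˡ-≤ (2 * k) _ _ (begin
    2 * k + suc (zeros v)  ≤⟨ ℕ.+-monoʳ-≤ (2 * k) (ℕ.n≤1+n _) ⟩
    2 * k + (2 + zeros v)  ≡⟨ ℕ.+-assoc (2 * k) 2 (zeros v) ⟨
    2 * k + 2 + zeros v    ≤⟨ ℕ.+-monoˡ-≤ (zeros v) d≤wt ⟩
    wt v + zeros v         ≡⟨ wt+zeros v ⟩
    6 * k                  ≡⟨ six≡2+4 k ⟩
    2 * k + 2 * k * 2      ∎)
  listed : 2 ∣ zeros v → zeros v ∈ applyUpTo (2 *_) (2 * k)
  listed (divides l zeros≡l*2) =
    subst (_∈ applyUpTo (2 *_) (2 * k)) (trans (ℕ.*-comm 2 l) (sym zeros≡l*2))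
          (∈-applyUpTo⁺ (2 *_) (ℕ.*-cancelʳ-< 2 l (2 * k) (subst (_< 2 * k * 2) zeros≡l*2 zeros<4k)))

coverCount-uniform : {k : ℕ} (C : Code (6 * k)) → Extremal C →
                     (x₀ : Word (6 * k)) → x₀ ∈C C → 1 ≤ wt x₀ →
                     (x x′ : Word (6 * k)) → wt x ≡ 2 → wt x′ ≡ 2 →
                     coverCount (codewordsOfWeight C (wt x₀)) x ≡ coverCount (codewordsOfWeight C (wt x₀)) x′
coverCount-uniform {k} C extremal@(selfDual , _ , minWeight , _) x₀ x₀∈C 1≤wt x x′ wt-x wt-x′ =
  +-injective (trans (coverCount≡coverSum C x x₀) (trans uniform (sym (coverCount≡coverSum C x′ x₀))))
  where
  L : List ℕ
  L = applyUpTo (2 *_) (2 * k)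
  x₀≢0 : x₀ ≢ zeroW
  x₀≢0 x₀≡0 = contradiction (subst (1 ≤_) (trans (cong wt x₀≡0) (wt-zeroW {6 * k})) 1≤wt) λ ()
  bound : wt x + length L ≤ 2 * (6 * k / 6) + 2
  bound = subst₂ _≤_ (sym (cong₂ _+_ wt-x (length-applyUpTo (2 *_) (2 * k))))
                     (cong (λ m → 2 * m + 2) (sym (6k/6≡k k)))
                     (ℕ.≤-reflexive (ℕ.+-comm 2 (2 * k)))
  δ₀ : ℕ → ℤ
  δ₀ z = ⟦ ⌊ z ℕ.≟ zeros x₀ ⌋ ⟧
  uniform : coverSum C x δ₀ ≡ coverSum C x′ δ₀
  uniform = coverSum-indicator-uniform C selfDual minWeight L (zeros-of-extremal-codeword {k} {C} extremal)
              (zeros-of-extremal-codeword {k} {C} extremal x₀ x₀∈C x₀≢0) x x′ (trans wt-x (sym wt-x′))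
              (subst (1 ≤_) (sym wt-x) (s≤s z≤n)) bound

theorem17 : (k : ℕ) (C : Code (6 * k)) → Extremal C →
    ∀ (w : ℕ) → 1 ≤ w → (Σ (Word (6 * k)) λ x → x ∈C C × wt x ≡ w) →
    Σ ℕ λ μ → GenDesign 2 w μ (codewordsOfWeight C w)
theorem17 zero    C extremal w 1≤w ([] , _ , refl) = contradiction 1≤w λ ()
theorem17 (suc k) C extremal w 1≤w (x₀ , x₀∈C , refl) =
  coverCount Y x₂ , codewordsOfWeight-nonempty C x₀ x₀∈C , (λ _ → codewordsOfWeight-wt C) , uniform
  where
  Y : List (Word (6 * suc k))
  Y = codewordsOfWeight C (wt x₀)
  2≤n : 2 ≤ 6 * suc k
  2≤n = ℕ.≤-trans (s≤s (s≤s z≤n)) (ℕ.m≤m*n 6 (suc k))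
  x₂ : Word (6 * suc k)
  x₂ = proj₁ (weight-two-word 2≤n)
  uniform : ∀ x → wt x ≡ 2 → coverCount Y x ≡ coverCount Y x₂
  uniform x wt-x =
    coverCount-uniform {suc k} C extremal x₀ x₀∈C 1≤w x x₂ wt-x (proj₂ (weight-two-word 2≤n))
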